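{- For all $\ell\ge 3$ and $n\ge \ell$, \(\widehat P^{(3)}(n,\ell)\subseteq DI(n,\ell)\).
   Context: Let $\mathbf{k}$ be a field of characteristic zero and $S_n=\mathbf{k}[x_1,\ldots,x_n]$. For a 3-graph $G$ with vertex set contained in $[n]$, define $p_G=\prod_{1\le i<j<k\le n,\ ijk\notin G}(x_i-x_j)(x_i-x_k)(x_j-x_k)$. Let $I(n,\ell)\subset S_n$ be the ideal of polynomials that vanish after the identification of any $\ell$ variables. Define $DI(n,\ell)=\{p\in S_n: \partial^j p/\partial x_i^j\in I(n,\ell)$ for every $i\in[n]$ and every $0\le j\le n-3\}$. Let $\widehat P^{(3)}(n,\ell)$ be the ideal of $S_n$ generated by the polynomials $p_G$ with $G$ ranging over all $(\ell-1)$-partite 3-graphs with vertex set contained in $[n]$. -}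

module Defs where

open import Level using (_⊔_; suc)
open import Algebra.Bundles using (CommutativeRing; Semiring)
import Algebra.Definitions.RawSemiring as RSDefs
open import Data.Nat as ℕ using (ℕ; zero; _<_; _≤_; _∸_)
open import Data.Fin as Fin using (Fin; toℕ)
open import Data.Fin.Subset using (Subset; _∈_; ∣_∣; inside; outside)
open import Data.Vec using (Vec; lookup; tabulate; updateAt; replicate)
open import Data.List as List using (List; []; _∷_; _++_; map; concatMap; filter; foldr; allFin)
open import Data.Product using (Σ; _×_; _,_; ∃; proj₁; proj₂)
open import Data.Bool using (Bool; true; false; if_then_else_)
open import Relation.Nullary using (¬_; Dec; yes; no)
open import Relation.Nullary.Decidable using (does)
open import Relation.Binary.PropositionalEquality using (_≡_)
import Data.Vec.Properties as VecP
import Data.Nat.Properties as ℕP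
import Data.Fin.Properties as FinP
import Data.Vec
import Data.List.Relation.Unary.All

record Field (c ℓ : Level.Level) : Set (Level.suc (c ⊔ ℓ)) where
  field
    commutativeRing : CommutativeRing c ℓ
  open CommutativeRing commutativeRing public
  field
    0≉1     : ¬ (0# ≈ 1#)
    inverse : ∀ x → ¬ (x ≈ 0#) → Σ Carrier λ y → (x * y) ≈ 1#

CharZero : ∀ {c ℓ} → Field c ℓ → Set ℓ
CharZero F = ∀ (m : ℕ) → ¬ ((ℕ.suc m ·ℕ 1#) ≈ 0#)
  where open Field F
        open RSDefs (Semiring.rawSemiring (CommutativeRing.semiring commutativeRing)) renaming (_×_ to _·ℕ_)

-- Polynomials in n variables over a commutative ring, represented as
-- finite lists of terms (coefficient, exponent vector).  Two such
-- lists denote the same polynomial iff every monomial has the same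
-- coefficient.

module Polynomials {c ℓ} (R : CommutativeRing c ℓ) where
  open CommutativeRing R
  open RSDefs (Semiring.rawSemiring semiring) renaming (_×_ to _·ℕ_)

  Monomial : ℕ → Set
  Monomial n = Vec ℕ n

  Poly : ℕ → Set c
  Poly n = List (Carrier × Monomial n)

  coeff : ∀ {n} → Poly n → Monomial n → Carrier
  coeff []             m = 0#
  coeff ((a , e) ∷ ps) m =
    if does (VecP.≡-dec ℕP._≟_ e m) then a + coeff ps m else coeff ps m

  _≋_ : ∀ {n} → Poly n → Poly n → Set ℓ
  p ≋ q = ∀ m → coeff p m ≈ coeff q m

  IsZero : ∀ {n} → Poly n → Set ℓ
  IsZero p = ∀ m → coeff p m ≈ 0#

  0ₚ : ∀ {n} → Poly n
  0ₚ = []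

  1ₚ : ∀ {n} → Poly n
  1ₚ = (1# , replicate _ 0) ∷ []

  _+ₚ_ : ∀ {n} → Poly n → Poly n → Poly n
  p +ₚ q = p ++ q

  _*ₚ_ : ∀ {n} → Poly n → Poly n → Poly n
  p *ₚ q = concatMap (λ { (a , e) → map (λ { (b , f) → (a * b , Data.Vec.zipWith ℕ._+_ e f) }) q }) p

  negₚ : ∀ {n} → Poly n → Poly n
  negₚ p = map (λ { (a , e) → (- a , e) }) p

  _-ₚ_ : ∀ {n} → Poly n → Poly n → Poly n
  p -ₚ q = p +ₚ negₚ q

  prodₚ : ∀ {n} → List (Poly n) → Poly n
  prodₚ = foldr _*ₚ_ 1ₚ

  sumₚ : ∀ {n} → List (Poly n) → Poly n
  sumₚ = foldr _+ₚ_ 0ₚ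

  var : ∀ {n} → Fin n → Poly n
  var {n} i = (1# , tabulate (λ k → if does (k Fin.≟ i) then 1 else 0)) ∷ []

  ∂ : ∀ {n} → Fin n → Poly n → Poly n
  ∂ i []             = []
  ∂ i ((a , e) ∷ ps) with lookup e i
  ... | zero    = ∂ i ps
  ... | ℕ.suc k = ((ℕ.suc k ·ℕ a) , updateAt e i (λ _ → k)) ∷ ∂ i ps

  ∂^ : ∀ {n} → ℕ → Fin n → Poly n → Poly n
  ∂^ zero    i p = p
  ∂^ (ℕ.suc j) i p = ∂ i (∂^ j i p)

  -- Identification of the variables indexed by S (all set equal to x_r,
  -- where r ∈ S): the substitution x_i ↦ x_r for i ∈ S.

  inS : ∀ {n} → Subset n → Fin n → Bool
  inS S i with lookup S i
  ... | inside  = true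
  ... | outside = false

  identifyMon : ∀ {n} → Subset n → Fin n → Monomial n → Monomial n
  identifyMon {n} S r e = tabulate λ k →
    if does (k Fin.≟ r)
      then foldr ℕ._+_ 0 (map (λ i → if inS S i then lookup e i else 0) (allFin n))
      else (if inS S k then 0 else lookup e k)

  identify : ∀ {n} → Subset n → Fin n → Poly n → Poly n
  identify S r = map (λ { (a , e) → (a , identifyMon S r e) })

  InI : (n ℓ' : ℕ) → Poly n → Set ℓ
  InI n ℓ' p = ∀ (S : Subset n) (r : Fin n) → r ∈ S → ∣ S ∣ ≡ ℓ' → IsZero (identify S r p)

  InDI : (n ℓ' : ℕ) → Poly n → Set ℓ
  InDI n ℓ' p = ∀ (i : Fin n) (j : ℕ) → j ≤ n ∸ 3 → InI n ℓ' (∂^ j i p)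

  -- 3-graphs on [n]: a decidable set of triples; only the values on
  -- triples i < j < k are relevant (edge ijk with i<j<k).

  ThreeGraph : ℕ → Set
  ThreeGraph n = Fin n → Fin n → Fin n → Bool

  Partite : ∀ {n} → ℕ → ThreeGraph n → Set
  Partite {n} m G = Σ (Fin n → Fin m) λ col →
    ∀ i j k → toℕ i < toℕ j → toℕ j < toℕ k → G i j k ≡ true →
      ¬ (col i ≡ col j) × ¬ (col i ≡ col k) × ¬ (col j ≡ col k)

  triples : (n : ℕ) → List (Fin n × Fin n × Fin n)
  triples n = concatMap (λ i → concatMap (λ j → concatMap (λ k →
      if does (toℕ i ℕ.<? toℕ j) then
        (if does (toℕ j ℕ.<? toℕ k) then (i , j , k) ∷ [] else [])
      else []) (allFin n)) (allFin n)) (allFin n)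

  notEdge : ∀ {n} → ThreeGraph n → Fin n × Fin n × Fin n → Bool
  notEdge G (i , j , k) = if G i j k then false else true

  pG : ∀ {n} → ThreeGraph n → Poly n
  pG {n} G = prodₚ (map (λ { (i , j , k) →
      ((var i -ₚ var j) *ₚ (var i -ₚ var k)) *ₚ (var j -ₚ var k) })
    (filter (λ t → Data.Bool._≟_ (notEdge G t) true) (triples n)))

  -- membership in the ideal \hat P^{(3)}(n, ℓ) generated by p_G for
  -- (ℓ-1)-partite 3-graphs G: p is a finite combination Σ q_t · p_{G_t}.
  InPhat : (n ℓ' : ℕ) → Poly n → Set (c ⊔ ℓ)
  InPhat n ℓ' p = Σ (List (Poly n × ThreeGraph n)) λ gens →
    Data.List.Relation.Unary.All.All (λ g → Partite (ℓ' ∸ 1) (proj₂ g)) gens ×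
    (p ≋ sumₚ (map (λ { (q , G) → q *ₚ pG G }) gens))

module Submission where

-- Fix a set S of ℓ variables and an (ℓ−1)-partite 3-graph G. By pigeonhole two indices a < b of S
-- lie in the same part, so no edge of G contains both: each of the n − 2 triples through {a, b} is a
-- non-edge whose factor in p_G is divisible by x_a − x_b. Hence p_G, and with it every element p of
-- P̂(n, ℓ), lies in J^(n−2), where J is the ideal generated by the differences x_a − x_b with a, b ∈ S.
-- By the Leibniz rule a partial derivative lowers this power by at most one, so ∂^j p lies in J for
-- j ≤ n − 3, and every element of J vanishes once the variables of S are identified.

open import Defs
open import Level using (Level)
open import Data.Nat using (ℕ; _≤_)
open import Algebra.Bundles using (CommutativeRing)

module Sums where
  open import Data.Bool using (if_then_else_)
  open import Data.Nat using (zero; suc; _+_; z≤n)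
  import Data.Nat.Properties as ℕP
  open import Data.Nat.ListAction using (sum)
  open import Data.Fin as Fin using (Fin)
  open import Data.List as List using (map; allFin)
  import Data.List.Properties as ListP
  open import Function using (id; _∘_)
  open import Relation.Nullary using (Dec)
  open import Relation.Nullary.Decidable using (does)
  open import Relation.Binary.PropositionalEquality
  open import Algebra.Properties.CommutativeSemigroup ℕP.+-commutativeSemigroup
    using () renaming (interchange to +-interchange; x∙yz≈y∙xz to +-exchange)

  ⟦_⟧ : ∀ {p} {P : Set p} → Dec P → ℕ
  ⟦ d ⟧ = if does d then 1 else 0

  ∑ : ∀ {n} → (Fin n → ℕ) → ℕ
  ∑ {zero}  f = 0
  ∑ {suc n} f = f Fin.zero + ∑ (f ∘ Fin.suc)

  sum-allFin : ∀ {n} (f : Fin n → ℕ) → sum (map f (allFin n)) ≡ ∑ f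
  sum-allFin {n} f = trans (cong sum (ListP.map-tabulate id f)) (sum-tabulate f)
    where
    sum-tabulate : ∀ {m} (g : Fin m → ℕ) → sum (List.tabulate g) ≡ ∑ g
    sum-tabulate {zero}  g = refl
    sum-tabulate {suc m} g = cong (g Fin.zero +_) (sum-tabulate (g ∘ Fin.suc))

  ∑-cong : ∀ {n} {f g : Fin n → ℕ} → (∀ i → f i ≡ g i) → ∑ f ≡ ∑ g
  ∑-cong {zero}  f≗g = refl
  ∑-cong {suc n} f≗g = cong₂ _+_ (f≗g Fin.zero) (∑-cong (f≗g ∘ Fin.suc))

  ∑-mono : ∀ {n} {f g : Fin n → ℕ} → (∀ i → f i ≤ g i) → ∑ f ≤ ∑ g
  ∑-mono {zero}  f≤g = z≤n
  ∑-mono {suc n} f≤g = ℕP.+-mono-≤ (f≤g Fin.zero) (∑-mono (f≤g ∘ Fin.suc))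

  ∑-distrib-+ : ∀ {n} (f g : Fin n → ℕ) → ∑ (λ i → f i + g i) ≡ ∑ f + ∑ g
  ∑-distrib-+ {zero}  f g = refl
  ∑-distrib-+ {suc n} f g =
    trans (cong (f Fin.zero + g Fin.zero +_) (∑-distrib-+ (f ∘ Fin.suc) (g ∘ Fin.suc)))
          (+-interchange (f Fin.zero) (g Fin.zero) _ _)

  ∑-const-1 : ∀ n → ∑ {n} (λ _ → 1) ≡ n
  ∑-const-1 zero    = refl
  ∑-const-1 (suc n) = cong suc (∑-const-1 n)

  ∑-δ : ∀ {n} (a : Fin n) → ∑ (λ i → ⟦ i Fin.≟ a ⟧) ≡ 1
  ∑-δ {suc n} Fin.zero    = cong suc (∑-const-0 n)
    where
    ∑-const-0 : ∀ m → ∑ {m} (λ _ → 0) ≡ 0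
    ∑-const-0 zero    = refl
    ∑-const-0 (suc m) = ∑-const-0 m
  ∑-δ {suc n} (Fin.suc a) = ∑-δ a

  ≤∑ : ∀ {n} (f : Fin n → ℕ) x → f x ≤ ∑ f
  ≤∑ f Fin.zero    = ℕP.m≤m+n _ _
  ≤∑ f (Fin.suc x) = ℕP.≤-trans (≤∑ (f ∘ Fin.suc) x) (ℕP.m≤n+m _ _)

  +∑≤∑ : ∀ {n} {f g : Fin n → ℕ} x → g x ≡ 0 → (∀ i → g i ≤ f i) → f x + ∑ g ≤ ∑ f
  +∑≤∑ {suc n} Fin.zero    gx≡0 g≤f rewrite gx≡0 = ℕP.+-monoʳ-≤ _ (∑-mono (g≤f ∘ Fin.suc))
  +∑≤∑ {suc n} {f} {g} (Fin.suc x) gx≡0 g≤f =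
    ℕP.≤-trans (ℕP.≤-reflexive (+-exchange (f (Fin.suc x)) (g Fin.zero) _))
               (ℕP.+-mono-≤ (g≤f Fin.zero) (+∑≤∑ x gx≡0 (g≤f ∘ Fin.suc)))


module Pigeonhole where
  open import Data.Nat using (_<_; z≤n; s≤s)
  open import Data.Fin as Fin using (Fin; toℕ)
  import Data.Fin.Properties as FinP
  open import Data.Fin.Subset using (Subset; _∈_; ∣_∣; inside; outside)
  open import Data.Vec as Vec using ()
  open import Data.Product using (∃₂; _×_; _,_)
  open import Function using (_∘_)
  open import Relation.Binary.PropositionalEquality using (_≡_)

  element : ∀ {n} (S : Subset n) → Fin ∣ S ∣ → Fin n
  element (inside  Vec.∷ S) Fin.zero    = Fin.zero
  element (inside  Vec.∷ S) (Fin.suc i) = Fin.suc (element S i)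
  element (outside Vec.∷ S) i           = Fin.suc (element S i)

  element-∈ : ∀ {n} (S : Subset n) i → element S i ∈ S
  element-∈ (inside  Vec.∷ S) Fin.zero    = Vec.here
  element-∈ (inside  Vec.∷ S) (Fin.suc i) = Vec.there (element-∈ S i)
  element-∈ (outside Vec.∷ S) i           = Vec.there (element-∈ S i)

  element-mono : ∀ {n} (S : Subset n) {i j} → i Fin.< j → element S i Fin.< element S j
  element-mono (inside  Vec.∷ S) {Fin.zero}  {Fin.suc j} _         = s≤s z≤n
  element-mono (inside  Vec.∷ S) {Fin.suc i} {Fin.suc j} (s≤s i<j) = s≤s (element-mono S i<j)
  element-mono (outside Vec.∷ S)                         i<j       = s≤s (element-mono S i<j)

  pigeonhole-⊆ : ∀ {m n} (S : Subset n) (f : Fin n → Fin m) → m < ∣ S ∣ →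
                 ∃₂ λ a b → a ∈ S × b ∈ S × toℕ a < toℕ b × f a ≡ f b
  pigeonhole-⊆ S f m<∣S∣ with i , j , i<j , fi≡fj ← FinP.pigeonhole m<∣S∣ (f ∘ element S) =
    element S i , element S j , element-∈ S i , element-∈ S j , element-mono S i<j , fi≡fj

open Sums
open Pigeonhole

module Triples where
  open import Data.Bool using (if_then_else_)
  open import Data.Nat as ℕ using (_+_; _<_)
  open import Data.Fin as Fin using (Fin; toℕ)
  open import Data.List as List using (List; []; _∷_; _++_; map; concatMap; filter; allFin; length)
  open import Data.Nat.ListAction using (sum)
  import Data.List.Properties as ListP
  open import Data.Product using (_×_; _,_)
  open import Relation.Nullary using (Dec; yes; no)
  open import Relation.Nullary.Decidable using (does)
  open import Relation.Binary.PropositionalEquality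

  data Through {n} (a b : Fin n) : Fin n × Fin n × Fin n → Set where
    ab∙ : ∀ k → Through a b (a , b , k)
    a∙b : ∀ j → Through a b (a , j , b)
    ∙ab : ∀ i → Through a b (i , a , b)

  through? : ∀ {n} (a b : Fin n) t → Dec (Through a b t)
  through? a b (i , j , k) with i Fin.≟ a | j Fin.≟ a | j Fin.≟ b | k Fin.≟ b
  ... | yes refl | _        | yes refl | _        = yes (ab∙ k)
  ... | yes refl | _        | no _     | yes refl = yes (a∙b j)
  ... | yes refl | _        | no j≢b   | no k≢b   =
    no λ { (ab∙ _) → j≢b refl ; (a∙b _) → k≢b refl ; (∙ab _) → k≢b refl }
  ... | no _     | yes refl | _        | yes refl = yes (∙ab i)
  ... | no i≢a   | yes refl | _        | no k≢b   =
    no λ { (ab∙ _) → i≢a refl ; (a∙b _) → i≢a refl ; (∙ab _) → k≢b refl }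
  ... | no i≢a   | no j≢a   | _        | _        =
    no λ { (ab∙ _) → i≢a refl ; (a∙b _) → i≢a refl ; (∙ab _) → j≢a refl }

  Increasing : ∀ {n} → Fin n × Fin n × Fin n → Set
  Increasing (i , j , k) = toℕ i < toℕ j × toℕ j < toℕ k

  triplesAt : ∀ {n} (i j k : Fin n) → List (Fin n × Fin n × Fin n)
  triplesAt i j k = if does (toℕ i ℕ.<? toℕ j)
    then (if does (toℕ j ℕ.<? toℕ k) then (i , j , k) ∷ [] else [])
    else []

  length-filter-concatMap : ∀ {b p} {B : Set b} {P : B → Set p} (P? : ∀ x → Dec (P x)) {n}
    (f : Fin n → List B) → length (filter P? (concatMap f (allFin n))) ≡ ∑ (λ i → length (filter P? (f i)))
  length-filter-concatMap P? {n} f = trans (go (allFin n)) (sum-allFin (λ i → length (filter P? (f i))))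
    where
    go : ∀ xs → length (filter P? (concatMap f xs)) ≡ sum (map (λ x → length (filter P? (f x))) xs)
    go []       = refl
    go (x ∷ xs) = begin
      length (filter P? (f x ++ concatMap f xs))                     ≡⟨ cong length (ListP.filter-++ P? (f x) _) ⟩
      length (filter P? (f x) ++ filter P? (concatMap f xs))         ≡⟨ ListP.length-++ (filter P? (f x)) ⟩
      length (filter P? (f x)) + length (filter P? (concatMap f xs)) ≡⟨ cong (_ +_) (go xs) ⟩
      length (filter P? (f x)) + sum (map (λ x → length (filter P? (f x))) xs) ∎
      where open ≡-Reasoning

open Triples

-- R only gives access to triples, which Defs places inside Polynomials.
module TriplesThroughPair {c ℓ} (R : CommutativeRing c ℓ) where
  open import Data.Bool using (false; true)
  open import Data.Nat as ℕ using (_+_; _∸_; _<_)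
  import Data.Nat.Properties as ℕP
  open import Data.Fin as Fin using (Fin; toℕ; _≟_)
  import Data.Fin.Properties as FinP
  open FinP using (_<?_)
  open import Data.List as List using (List; []; _∷_; concatMap; filter; allFin; length)
  open import Data.List.Relation.Unary.All as All using (All; []; _∷_)
  import Data.List.Relation.Unary.All.Properties as AllP
  open import Data.Product using (_×_; _,_; proj₁; proj₂)
  open import Data.Empty using (⊥-elim)
  open import Function using (_∘_)
  open import Relation.Nullary using (yes; no)
  open import Relation.Nullary.Decidable using (dec-true; dec-false; _×-dec_)
  open import Relation.Binary.Definitions using (tri<; tri≈; tri>)
  open import Relation.Binary.PropositionalEquality
  open Polynomials R using (triples)

  triples-increasing : ∀ n → All Increasing (triples n)
  triples-increasing n =
    concatMap⁺ _ λ i → concatMap⁺ _ λ j → concatMap⁺ (triplesAt i j) (triplesAt-increasing i j)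
    where
    concatMap⁺ : ∀ (f : Fin n → List (Fin n × Fin n × Fin n)) →
                 (∀ x → All Increasing (f x)) → All Increasing (concatMap f (allFin n))
    concatMap⁺ f f-increasing = AllP.concat⁺ (AllP.map⁺ (All.universal f-increasing (allFin n)))
    triplesAt-increasing : ∀ i j k → All Increasing (triplesAt i j k)
    triplesAt-increasing i j k with i <? j | j <? k
    ... | no i≮j  | _       rewrite dec-false (i <? j) i≮j = []
    ... | yes i<j | no j≮k  rewrite dec-true (i <? j) i<j | dec-false (j <? k) j≮k = []
    ... | yes i<j | yes j<k rewrite dec-true (i <? j) i<j | dec-true (j <? k) j<k = (i<j , j<k) ∷ []

  module _ {n} {a b : Fin n} (a<b : toℕ a < toℕ b) where

    hits : Fin n → Fin n → Fin n → ℕ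
    hits i j k = length (filter (through? a b) (triplesAt i j k))

    below above between : Fin n → ℕ
    below x   = ⟦ x <? a ⟧
    above x   = ⟦ b <? x ⟧
    between x = ⟦ a <? x ×-dec x <? b ⟧

    length-filter-triples : length (filter (through? a b) (triples n)) ≡ ∑ λ i → ∑ λ j → ∑ λ k → hits i j k
    length-filter-triples =
      trans (length-filter-concatMap (through? a b) λ i → concatMap (λ j → concatMap (triplesAt i j) (allFin n)) (allFin n))
      (∑-cong λ i → trans (length-filter-concatMap (through? a b) λ j → concatMap (triplesAt i j) (allFin n))
      (∑-cong λ j → length-filter-concatMap (through? a b) (triplesAt i j)))

    hits-∙ab : ∀ i → hits i a b ≡ below i
    hits-∙ab i with toℕ i ℕ.<ᵇ toℕ a
    ... | false = refl
    ... | true rewrite dec-true (a <? b) a<b | dec-true (through? a b (i , a , b)) (∙ab i) = refl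

    hits-a∙b : ∀ j → hits a j b ≡ between j
    hits-a∙b j with toℕ a ℕ.<ᵇ toℕ j | toℕ j ℕ.<ᵇ toℕ b
    ... | false | _     = refl
    ... | true  | false = refl
    ... | true  | true rewrite dec-true (through? a b (a , j , b)) (a∙b j) = refl

    hits-ab∙ : ∀ k → hits a b k ≡ above k
    hits-ab∙ k rewrite dec-true (a <? b) a<b with toℕ b ℕ.<ᵇ toℕ k
    ... | false = refl
    ... | true rewrite dec-true (through? a b (a , b , k)) (ab∙ k) = refl

    partition : ∀ x → above x + between x + below x + (⟦ x ≟ a ⟧ + ⟦ x ≟ b ⟧) ≡ 1
    partition x with FinP.<-cmp x a | FinP.<-cmp x b
    ... | tri< x<a x≢a _ | tri< _ x≢b b≮x
      rewrite dec-false (b <? x) b≮x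
            | dec-false (a <? x ×-dec x <? b) (FinP.<-asym x<a ∘ proj₁)
            | dec-true (x <? a) x<a
            | dec-false (x ≟ a) x≢a
            | dec-false (x ≟ b) x≢b = refl
    ... | tri< x<a _ _ | tri≈ _ x≡b _ = ⊥-elim (FinP.<-irrefl x≡b (FinP.<-trans x<a a<b))
    ... | tri< x<a _ _ | tri> _ _ b<x = ⊥-elim (FinP.<-asym (FinP.<-trans x<a a<b) b<x)
    ... | tri≈ x≮a x≡a a≮x | tri< _ x≢b b≮x
      rewrite dec-false (b <? x) b≮x
            | dec-false (a <? x ×-dec x <? b) (a≮x ∘ proj₁)
            | dec-false (x <? a) x≮a
            | dec-true (x ≟ a) x≡a
            | dec-false (x ≟ b) x≢b = refl
    ... | tri≈ _ x≡a _ | tri≈ x≮b _ _ = ⊥-elim (x≮b (subst (Fin._< b) (sym x≡a) a<b))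
    ... | tri≈ _ x≡a _ | tri> x≮b _ _ = ⊥-elim (x≮b (subst (Fin._< b) (sym x≡a) a<b))
    ... | tri> x≮a x≢a a<x | tri< x<b x≢b b≮x
      rewrite dec-false (b <? x) b≮x
            | dec-true (a <? x ×-dec x <? b) (a<x , x<b)
            | dec-false (x <? a) x≮a
            | dec-false (x ≟ a) x≢a
            | dec-false (x ≟ b) x≢b = refl
    ... | tri> x≮a x≢a _ | tri≈ x≮b x≡b b≮x
      rewrite dec-false (b <? x) b≮x
            | dec-false (a <? x ×-dec x <? b) (x≮b ∘ proj₂)
            | dec-false (x <? a) x≮a
            | dec-false (x ≟ a) x≢a
            | dec-true (x ≟ b) x≡b = refl
    ... | tri> x≮a x≢a _ | tri> x≮b x≢b b<x
      rewrite dec-true (b <? x) b<x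
            | dec-false (a <? x ×-dec x <? b) (x≮b ∘ proj₂)
            | dec-false (x <? a) x≮a
            | dec-false (x ≟ a) x≢a
            | dec-false (x ≟ b) x≢b = refl

    ∑-partition : ∑ above + ∑ between + ∑ below + 2 ≡ n
    ∑-partition = begin
      ∑ above + ∑ between + ∑ below + 2
        ≡⟨ cong₂ (λ s t → s + ∑ below + t) (∑-distrib-+ above between) (cong₂ _+_ (∑-δ a) (∑-δ b)) ⟨
      ∑ (λ x → above x + between x) + ∑ below + (∑ (λ x → ⟦ x ≟ a ⟧) + ∑ (λ x → ⟦ x ≟ b ⟧))
        ≡⟨ cong₂ _+_ (∑-distrib-+ (λ x → above x + between x) below) (∑-distrib-+ (λ x → ⟦ x ≟ a ⟧) (λ x → ⟦ x ≟ b ⟧)) ⟨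
      ∑ (λ x → above x + between x + below x) + ∑ (λ x → ⟦ x ≟ a ⟧ + ⟦ x ≟ b ⟧)
        ≡⟨ ∑-distrib-+ (λ x → above x + between x + below x) (λ x → ⟦ x ≟ a ⟧ + ⟦ x ≟ b ⟧) ⟨
      ∑ (λ x → above x + between x + below x + (⟦ x ≟ a ⟧ + ⟦ x ≟ b ⟧))
        ≡⟨ ∑-cong partition ⟩
      ∑ {n} (λ _ → 1)
        ≡⟨ ∑-const-1 n ⟩
      n ∎
      where open ≡-Reasoning

    -- The triples (a,b,k) with b<k, (a,j,b) with a<j<b and (i,a,b) with i<a are pairwise distinct.
    ∑-lines≤length-filter-triples : ∑ above + ∑ between + ∑ below ≤ length (filter (through? a b) (triples n))
    ∑-lines≤length-filter-triples = begin
      ∑ above + ∑ between + ∑ below        ≡⟨ cong (λ s → s + ∑ between + ∑ below) (∑-cong (sym ∘ hits-ab∙)) ⟩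
      ∑ (hits a b) + ∑ between + ∑ below   ≤⟨ ℕP.+-monoˡ-≤ (∑ below) (+∑≤∑ b between-b≡0 between≤) ⟩
      hitsFrom a + ∑ below                 ≤⟨ +∑≤∑ a below-a≡0 below≤ ⟩
      ∑ hitsFrom                           ≡⟨ length-filter-triples ⟨
      length (filter (through? a b) (triples n)) ∎
      where
      open ℕP.≤-Reasoning
      hitsFrom : Fin n → ℕ
      hitsFrom i = ∑ λ j → ∑ (hits i j)
      between≤ : ∀ j → between j ≤ ∑ (hits a j)
      between≤ j = ℕP.≤-trans (ℕP.≤-reflexive (sym (hits-a∙b j))) (≤∑ (hits a j) b)
      below≤ : ∀ i → below i ≤ hitsFrom i
      below≤ i = ℕP.≤-trans (ℕP.≤-reflexive (sym (hits-∙ab i)))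
                            (ℕP.≤-trans (≤∑ (hits i a) b) (≤∑ (λ j → ∑ (hits i j)) a))
      between-b≡0 : between b ≡ 0
      between-b≡0 rewrite dec-false (a <? b ×-dec b <? b) (FinP.<-irrefl refl ∘ proj₂) = refl
      below-a≡0 : below a ≡ 0
      below-a≡0 rewrite dec-false (a <? a) (FinP.<-irrefl refl) = refl

    n∸2≤length-filter-triples : n ∸ 2 ≤ length (filter (through? a b) (triples n))
    n∸2≤length-filter-triples = begin
      n ∸ 2                                ≡⟨ cong (_∸ 2) ∑-partition ⟨
      ∑ above + ∑ between + ∑ below + 2 ∸ 2 ≡⟨ ℕP.m+n∸n≡m _ 2 ⟩
      ∑ above + ∑ between + ∑ below        ≤⟨ ∑-lines≤length-filter-triples ⟩
      length (filter (through? a b) (triples n)) ∎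
      where open ℕP.≤-Reasoning

module PolynomialAlgebra {c ℓ} (R : CommutativeRing c ℓ) where
  open import Level using (_⊔_)
  open import Data.Bool using (if_then_else_)
  open import Data.Nat as ℕ using (zero; suc; _≤_; s≤s)
  import Data.Nat.Properties as ℕP
  open import Data.Fin as Fin using (Fin)
  open import Data.List as List using ([]; _∷_; _++_; map; concatMap; filter; length; allFin)
  import Data.List.Properties as ListP
  open import Data.Vec using (lookup; updateAt; zipWith; tabulate)
  open import Data.Fin.Subset using (Subset; _∈_; inside; outside)
  open import Data.Nat.ListAction using (sum)
  import Data.Vec.Properties as VecP
  open import Data.Product using (_×_; _,_; proj₁; proj₂)
  open import Data.Empty using (⊥-elim)
  open import Relation.Nullary using (Dec; yes; no; ¬?)
  open import Relation.Nullary.Decidable using (does; dec-false)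
  open import Relation.Binary.PropositionalEquality as ≡ using (_≡_; _≢_)
  open CommutativeRing R
  open Polynomials R
  open import Algebra.Properties.Semiring.Mult semiring using (×-homo-+; ×-assoc-*; ×-comm-*; ×-congʳ) renaming (_×_ to _·ℕ_)
  open import Algebra.Properties.CommutativeMonoid.Mult +-commutativeMonoid using (×-distrib-+)
  open import Algebra.Properties.Group +-group using (identityʳ-unique)
  open import Algebra.Properties.CommutativeSemigroup +-commutativeSemigroup using (interchange; x∙yz≈y∙xz)
  import Relation.Binary.Reasoning.Setoid setoid as ≈-Reasoning

  _≟ₘ_ : ∀ {n} (e f : Monomial n) → Dec (e ≡ f)
  _≟ₘ_ = VecP.≡-dec ℕP._≟_

  _⊕_ : ∀ {n} → Monomial n → Monomial n → Monomial n
  _⊕_ = zipWith ℕ._+_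

  sumTerms : ∀ {n} → (Carrier → Monomial n → Carrier) → Poly n → Carrier
  sumTerms g []             = 0#
  sumTerms g ((a , e) ∷ p) = g a e + sumTerms g p

  termCoeff : ∀ {n} → Monomial n → Carrier → Monomial n → Carrier
  termCoeff m a e = if does (e ≟ₘ m) then a else 0#

  record IsAdditive {n} (g : Carrier → Monomial n → Carrier) : Set (c ⊔ ℓ) where
    field
      cong : ∀ e {a b} → a ≈ b → g a e ≈ g b e
      homo : ∀ e a b → g (a + b) e ≈ g a e + g b e

    0-homo : ∀ e → g 0# e ≈ 0#
    0-homo e = identityʳ-unique (g 0# e) (g 0# e) (sym (trans (cong e (sym (+-identityʳ 0#))) (homo e 0# 0#)))

  termCoeff-additive : ∀ {n} (m : Monomial n) → IsAdditive (termCoeff m)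
  termCoeff-additive m = record { cong = cong′ ; homo = homo′ }
    where
    cong′ : ∀ e {a b} → a ≈ b → termCoeff m a e ≈ termCoeff m b e
    cong′ e a≈b with e ≟ₘ m
    ... | yes _ = a≈b
    ... | no _  = refl
    homo′ : ∀ e a b → termCoeff m (a + b) e ≈ termCoeff m a e + termCoeff m b e
    homo′ e a b with e ≟ₘ m
    ... | yes _ = refl
    ... | no _  = sym (+-identityʳ 0#)

  additive-∘ : ∀ {n} {g h : Carrier → Monomial n → Carrier} (φ : Monomial n → Monomial n) →
               IsAdditive g → IsAdditive h → IsAdditive (λ a e → g (h a e) (φ e))
  additive-∘ φ G H = record
    { cong = λ e a≈b → G.cong (φ e) (H.cong e a≈b)
    ; homo = λ e a b → trans (G.cong (φ e) (H.homo e a b)) (G.homo (φ e) _ _) }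
    where module G = IsAdditive G
          module H = IsAdditive H

  *ʳ-additive : ∀ {n} (b : Carrier) → IsAdditive {n} (λ a _ → a * b)
  *ʳ-additive b = record { cong = λ _ → *-congʳ ; homo = λ _ x y → distribʳ b x y }

  *ˡ-additive : ∀ {n} (a : Carrier) → IsAdditive {n} (λ b _ → a * b)
  *ˡ-additive a = record { cong = λ _ → *-congˡ ; homo = λ _ x y → distribˡ a x y }

  ·ℕ-additive : ∀ {n} (k : Monomial n → ℕ) → IsAdditive (λ a e → k e ·ℕ a)
  ·ℕ-additive k = record { cong = λ e → ×-congʳ (k e) ; homo = λ e x y → ×-distrib-+ x y (k e) }

  sumTerms-++ : ∀ {n} g (p q : Poly n) → sumTerms g (p ++ q) ≈ sumTerms g p + sumTerms g q
  sumTerms-++ g []             q = sym (+-identityˡ _)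
  sumTerms-++ g ((a , e) ∷ p) q = trans (+-congˡ (sumTerms-++ g p q)) (sym (+-assoc _ _ _))

  sumTerms-pointwise : ∀ {n} {g h : Carrier → Monomial n → Carrier} →
                       (∀ a e → g a e ≈ h a e) → ∀ p → sumTerms g p ≈ sumTerms h p
  sumTerms-pointwise g≈h []             = refl
  sumTerms-pointwise g≈h ((a , e) ∷ p) = +-cong (g≈h a e) (sumTerms-pointwise g≈h p)

  sumTerms-distrib-+ : ∀ {n} (g h : Carrier → Monomial n → Carrier) p →
                       sumTerms (λ a e → g a e + h a e) p ≈ sumTerms g p + sumTerms h p
  sumTerms-distrib-+ g h []             = sym (+-identityʳ 0#)
  sumTerms-distrib-+ g h ((a , e) ∷ p) = trans (+-congˡ (sumTerms-distrib-+ g h p)) (interchange _ _ _ _)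

  sumTerms-zero : ∀ {n} {g : Carrier → Monomial n → Carrier} → (∀ a e → g a e ≈ 0#) → ∀ p → sumTerms g p ≈ 0#
  sumTerms-zero g≈0 []             = refl
  sumTerms-zero g≈0 ((a , e) ∷ p) = trans (+-cong (g≈0 a e) (sumTerms-zero g≈0 p)) (+-identityʳ 0#)

  sumTerms-additive : ∀ {n} {H : Carrier → Monomial n → Carrier → Monomial n → Carrier} →
                      (∀ b f → IsAdditive (λ a e → H a e b f)) → ∀ q → IsAdditive (λ a e → sumTerms (H a e) q)
  sumTerms-additive Hᵃ q = record
    { cong = λ e a≈a′ → sumTerms-pointwise (λ b f → IsAdditive.cong (Hᵃ b f) e a≈a′) q
    ; homo = λ e a a′ → trans (sumTerms-pointwise (λ b f → IsAdditive.homo (Hᵃ b f) e a a′) q)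
                              (sumTerms-distrib-+ _ _ q) }

  sumTerms-map : ∀ {n} g (φ : Carrier × Monomial n → Carrier × Monomial n) p →
                 sumTerms g (map φ p) ≡ sumTerms (λ a e → g (proj₁ (φ (a , e))) (proj₂ (φ (a , e)))) p
  sumTerms-map g φ []             = ≡.refl
  sumTerms-map g φ ((a , e) ∷ p) = ≡.cong (_ +_) (sumTerms-map g φ p)

  sumTerms-concatMap : ∀ {n} g (T : Carrier × Monomial n → Poly n) p →
                       sumTerms g (concatMap T p) ≈ sumTerms (λ a e → sumTerms g (T (a , e))) p
  sumTerms-concatMap g T []             = refl
  sumTerms-concatMap g T ((a , e) ∷ p) =
    trans (sumTerms-++ g (T (a , e)) (concatMap T p)) (+-congˡ (sumTerms-concatMap g T p))

  sumTerms-* : ∀ {n} g (p q : Poly n) →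
               sumTerms g (p *ₚ q) ≈ sumTerms (λ a e → sumTerms (λ b f → g (a * b) (e ⊕ f)) q) p
  sumTerms-* g p q = trans (sumTerms-concatMap g _ p) (sumTerms-pointwise (λ a e → reflexive (sumTerms-map g _ q)) p)

  coeff-sumTerms : ∀ {n} (p : Poly n) m → coeff p m ≈ sumTerms (termCoeff m) p
  coeff-sumTerms []             m = refl
  coeff-sumTerms ((a , e) ∷ p) m with e ≟ₘ m
  ... | yes _ = +-congˡ (coeff-sumTerms p m)
  ... | no _  = trans (coeff-sumTerms p m) (sym (+-identityˡ _))

  coeff-++ : ∀ {n} (p q : Poly n) m → coeff (p ++ q) m ≈ coeff p m + coeff q m
  coeff-++ p q m = begin
    coeff (p ++ q) m                                          ≈⟨ coeff-sumTerms (p ++ q) m ⟩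
    sumTerms (termCoeff m) (p ++ q)                           ≈⟨ sumTerms-++ (termCoeff m) p q ⟩
    sumTerms (termCoeff m) p + sumTerms (termCoeff m) q       ≈⟨ +-cong (coeff-sumTerms p m) (coeff-sumTerms q m) ⟨
    coeff p m + coeff q m                                     ∎
    where open ≈-Reasoning

  without : ∀ {n} → Monomial n → Poly n → Poly n
  without e = filter (λ t → ¬? (proj₂ t ≟ₘ e))

  coeff-without-self : ∀ {n} (e : Monomial n) p → coeff (without e p) e ≈ 0#
  coeff-without-self e []             = refl
  coeff-without-self e ((b , f) ∷ p) with f ≟ₘ e
  ... | yes _   = coeff-without-self e p
  ... | no f≢e rewrite dec-false (f ≟ₘ e) f≢e = coeff-without-self e p

  coeff-without-≢ : ∀ {n} {e m : Monomial n} → e ≢ m → ∀ p → coeff (without e p) m ≈ coeff p m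
  coeff-without-≢ e≢m []             = refl
  coeff-without-≢ {e = e} {m} e≢m ((b , f) ∷ p) with f ≟ₘ e
  ... | yes ≡.refl rewrite dec-false (e ≟ₘ m) e≢m = coeff-without-≢ e≢m p
  ... | no _ with f ≟ₘ m
  ...   | yes _ = +-congˡ (coeff-without-≢ e≢m p)
  ...   | no _  = coeff-without-≢ e≢m p

  without-cong : ∀ {n} (e : Monomial n) {p q} → p ≋ q → without e p ≋ without e q
  without-cong e {p} {q} p≋q m with e ≟ₘ m
  ... | yes ≡.refl = trans (coeff-without-self e p) (sym (coeff-without-self e q))
  ... | no e≢m     = trans (coeff-without-≢ e≢m p) (trans (p≋q m) (sym (coeff-without-≢ e≢m q)))

  length-without-head : ∀ {n} a (e : Monomial n) p → length (without e ((a , e) ∷ p)) ≤ length p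
  length-without-head a e p with e ≟ₘ e
  ... | yes _   = ListP.length-filter _ p
  ... | no e≢e = ⊥-elim (e≢e ≡.refl)

  module _ {n} {g : Carrier → Monomial n → Carrier} (additive : IsAdditive g) where
    open IsAdditive additive

    sumTerms-without : ∀ e p → sumTerms g p ≈ g (coeff p e) e + sumTerms g (without e p)
    sumTerms-without e []             = sym (trans (+-identityʳ _) (0-homo e))
    sumTerms-without e ((b , f) ∷ p) with f ≟ₘ e
    ... | yes ≡.refl = begin
      g b f + sumTerms g p                                   ≈⟨ +-congˡ (sumTerms-without f p) ⟩
      g b f + (g (coeff p f) f + sumTerms g (without f p))   ≈⟨ +-assoc _ _ _ ⟨
      g b f + g (coeff p f) f + sumTerms g (without f p)     ≈⟨ +-congʳ (homo f b (coeff p f)) ⟨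
      g (b + coeff p f) f + sumTerms g (without f p)         ∎
      where open ≈-Reasoning
    ... | no _ = trans (+-congˡ (sumTerms-without e p)) (x∙yz≈y∙xz _ _ _)

    -- Induction on the total length: split both sides at the monomial of a head term.
    sumTerms-cong : ∀ {p q} → p ≋ q → sumTerms g p ≈ sumTerms g q
    sumTerms-cong {p} {q} = go (length p ℕ.+ length q) p q ℕP.≤-refl
      where
      split : ∀ e p q → p ≋ q → sumTerms g (without e p) ≈ sumTerms g (without e q) → sumTerms g p ≈ sumTerms g q
      split e p q p≋q rest =
        trans (sumTerms-without e p) (trans (+-cong (cong e (p≋q e)) rest) (sym (sumTerms-without e q)))
      go : ∀ k p q → length p ℕ.+ length q ≤ k → p ≋ q → sumTerms g p ≈ sumTerms g q
      go k       []                []                _         _   = refl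
      go (suc k) p@((a , e) ∷ p′) q                 (s≤s len) p≋q =
        split e p q p≋q (go k (without e p) (without e q) shorter (without-cong e {p} {q} p≋q))
        where shorter = ℕP.≤-trans (ℕP.+-mono-≤ (length-without-head a e p′) (ListP.length-filter _ q)) len
      go (suc k) []                q@((b , e) ∷ q′) (s≤s len) p≋q =
        split e [] q p≋q (go k [] (without e q) shorter (without-cong e {[]} {q} p≋q))
        where shorter = ℕP.≤-trans (length-without-head b e q′) len

  lookup-ext : ∀ {n} {u v : Monomial n} → (∀ j → lookup u j ≡ lookup v j) → u ≡ v
  lookup-ext {u = u} {v} u≗v =
    ≡.trans (≡.sym (VecP.tabulate∘lookup u)) (≡.trans (VecP.tabulate-cong u≗v) (VecP.tabulate∘lookup v))

  lookup-⊕ : ∀ {n} (e f : Monomial n) j → lookup (e ⊕ f) j ≡ lookup e j ℕ.+ lookup f j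
  lookup-⊕ e f j = VecP.lookup-zipWith ℕ._+_ j e f

  updateAt-⊕ : ∀ {n} (e f : Monomial n) i {h h₁ h₂ : ℕ → ℕ} →
               h (lookup e i ℕ.+ lookup f i) ≡ h₁ (lookup e i) ℕ.+ h₂ (lookup f i) →
               updateAt (e ⊕ f) i h ≡ updateAt e i h₁ ⊕ updateAt f i h₂
  updateAt-⊕ e f i {h} {h₁} {h₂} split = lookup-ext component
    where
    component : ∀ j → lookup (updateAt (e ⊕ f) i h) j ≡ lookup (updateAt e i h₁ ⊕ updateAt f i h₂) j
    component j with j Fin.≟ i
    ... | yes ≡.refl = ≡.trans (VecP.lookup∘updateAt j (e ⊕ f)) (≡.trans (≡.cong h (lookup-⊕ e f j))
                       (≡.trans split (≡.sym (≡.trans (lookup-⊕ (updateAt e i h₁) (updateAt f i h₂) j)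
                         (≡.cong₂ ℕ._+_ (VecP.lookup∘updateAt j e) (VecP.lookup∘updateAt j f))))))
    ... | no j≢i     = ≡.trans (VecP.lookup∘updateAt′ j i j≢i (e ⊕ f)) (≡.trans (lookup-⊕ e f j)
                       (≡.sym (≡.trans (lookup-⊕ (updateAt e i h₁) (updateAt f i h₂) j)
                         (≡.cong₂ ℕ._+_ (VecP.lookup∘updateAt′ j i j≢i e) (VecP.lookup∘updateAt′ j i j≢i f)))))

  module Derivative {n} (i : Fin n) where

    ∂ₘ : Monomial n → Monomial n
    ∂ₘ e = updateAt e i ℕ.pred

    ∂ₘ-⊕ˡ : ∀ e f → lookup e i ≢ 0 → ∂ₘ (e ⊕ f) ≡ ∂ₘ e ⊕ f
    ∂ₘ-⊕ˡ e f eᵢ≢0 = ≡.trans (updateAt-⊕ e f i (pred-+ (lookup e i) eᵢ≢0)) (≡.cong (∂ₘ e ⊕_) (VecP.updateAt-id i f))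
      where
      pred-+ : ∀ x {y} → x ≢ 0 → ℕ.pred (x ℕ.+ y) ≡ ℕ.pred x ℕ.+ y
      pred-+ zero    x≢0 = ⊥-elim (x≢0 ≡.refl)
      pred-+ (suc x) _   = ≡.refl

    ∂ₘ-⊕ʳ : ∀ e f → lookup f i ≢ 0 → ∂ₘ (e ⊕ f) ≡ e ⊕ ∂ₘ f
    ∂ₘ-⊕ʳ e f fᵢ≢0 = ≡.trans (updateAt-⊕ e f i (+-pred (lookup f i) fᵢ≢0)) (≡.cong (_⊕ ∂ₘ f) (VecP.updateAt-id i e))
      where
      +-pred : ∀ {x} y → y ≢ 0 → ℕ.pred (x ℕ.+ y) ≡ x ℕ.+ ℕ.pred y
      +-pred zero    y≢0 = ⊥-elim (y≢0 ≡.refl)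
      +-pred {x} (suc y) _ = ≡.cong ℕ.pred (ℕP.+-suc x y)

    ∂-cons : ∀ a e p → ∂ i ((a , e) ∷ p) ≡ ∂ i ((a , e) ∷ []) ++ ∂ i p
    ∂-cons a e p with lookup e i
    ... | zero  = ≡.refl
    ... | suc _ = ≡.refl

    ∂-++ : ∀ (p q : Poly n) → ∂ i (p ++ q) ≡ ∂ i p ++ ∂ i q
    ∂-++ []             q = ≡.refl
    ∂-++ ((a , e) ∷ p) q = begin
      ∂ i ((a , e) ∷ p ++ q)                  ≡⟨ ∂-cons a e (p ++ q) ⟩
      ∂ i ((a , e) ∷ []) ++ ∂ i (p ++ q)      ≡⟨ ≡.cong (∂ i ((a , e) ∷ []) ++_) (∂-++ p q) ⟩
      ∂ i ((a , e) ∷ []) ++ ∂ i p ++ ∂ i q    ≡⟨ ListP.++-assoc (∂ i ((a , e) ∷ [])) (∂ i p) (∂ i q) ⟨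
      (∂ i ((a , e) ∷ []) ++ ∂ i p) ++ ∂ i q  ≡⟨ ≡.cong (_++ ∂ i q) (∂-cons a e p) ⟨
      ∂ i ((a , e) ∷ p) ++ ∂ i q              ∎
      where open ≡.≡-Reasoning

    module _ {g : Carrier → Monomial n → Carrier} (additive : IsAdditive g) where
      open IsAdditive additive

      sumTerms-∂-term : ∀ a e → sumTerms g (∂ i ((a , e) ∷ [])) ≈ g (lookup e i ·ℕ a) (∂ₘ e)
      sumTerms-∂-term a e with lookup e i in eᵢ
      ... | zero  = sym (0-homo (∂ₘ e))
      ... | suc k = trans (+-identityʳ _)
                          (reflexive (≡.cong (g _) (VecP.updateAt-cong-local i e (≡.cong ℕ.pred (≡.sym eᵢ)))))

      -- A term whose exponent of x_i is 0 contributes g (0 ·ℕ a) _ ≈ 0#, so one formula covers both clauses of ∂.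
      sumTerms-∂ : ∀ p → sumTerms g (∂ i p) ≈ sumTerms (λ a e → g (lookup e i ·ℕ a) (∂ₘ e)) p
      sumTerms-∂ []             = refl
      sumTerms-∂ ((a , e) ∷ p) = begin
        sumTerms g (∂ i ((a , e) ∷ p))                            ≡⟨ ≡.cong (sumTerms g) (∂-cons a e p) ⟩
        sumTerms g (∂ i ((a , e) ∷ []) ++ ∂ i p)                  ≈⟨ sumTerms-++ g (∂ i ((a , e) ∷ [])) (∂ i p) ⟩
        sumTerms g (∂ i ((a , e) ∷ [])) + sumTerms g (∂ i p)      ≈⟨ +-cong (sumTerms-∂-term a e) (sumTerms-∂ p) ⟩
        g (lookup e i ·ℕ a) (∂ₘ e) + sumTerms _ p                 ∎
        where open ≈-Reasoning

      ·ℕ-monomial-irrelevant : ∀ k x {M M′} → (k ≢ 0 → M ≡ M′) → g (k ·ℕ x) M ≈ g (k ·ℕ x) M′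
      ·ℕ-monomial-irrelevant zero    x _    = trans (0-homo _) (sym (0-homo _))
      ·ℕ-monomial-irrelevant (suc k) x M≡M′ = reflexive (≡.cong (g _) (M≡M′ (λ ())))

      leibniz-term : ∀ a e b f → g (lookup (e ⊕ f) i ·ℕ (a * b)) (∂ₘ (e ⊕ f)) ≈
                                 g ((lookup e i ·ℕ a) * b) (∂ₘ e ⊕ f) + g (a * (lookup f i ·ℕ b)) (e ⊕ ∂ₘ f)
      leibniz-term a e b f = begin
        g (lookup (e ⊕ f) i ·ℕ (a * b)) (∂ₘ (e ⊕ f))
          ≡⟨ ≡.cong (λ k → g (k ·ℕ (a * b)) (∂ₘ (e ⊕ f))) (lookup-⊕ e f i) ⟩
        g ((eᵢ ℕ.+ fᵢ) ·ℕ (a * b)) (∂ₘ (e ⊕ f))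
          ≈⟨ trans (cong _ (×-homo-+ (a * b) eᵢ fᵢ)) (homo _ _ _) ⟩
        g (eᵢ ·ℕ (a * b)) (∂ₘ (e ⊕ f)) + g (fᵢ ·ℕ (a * b)) (∂ₘ (e ⊕ f))
          ≈⟨ +-cong (·ℕ-monomial-irrelevant eᵢ (a * b) (∂ₘ-⊕ˡ e f)) (·ℕ-monomial-irrelevant fᵢ (a * b) (∂ₘ-⊕ʳ e f)) ⟩
        g (eᵢ ·ℕ (a * b)) (∂ₘ e ⊕ f) + g (fᵢ ·ℕ (a * b)) (e ⊕ ∂ₘ f)
          ≈⟨ +-cong (cong _ (×-assoc-* eᵢ a b)) (cong _ (×-comm-* fᵢ a b)) ⟨
        g ((eᵢ ·ℕ a) * b) (∂ₘ e ⊕ f) + g (a * (fᵢ ·ℕ b)) (e ⊕ ∂ₘ f) ∎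
        where
        open ≈-Reasoning
        eᵢ = lookup e i
        fᵢ = lookup f i

    coeff-∂ : ∀ p m → coeff (∂ i p) m ≈ sumTerms (λ a e → termCoeff m (lookup e i ·ℕ a) (∂ₘ e)) p
    coeff-∂ p m = trans (coeff-sumTerms (∂ i p) m) (sumTerms-∂ (termCoeff-additive m) p)

    ∂-cong : ∀ {p q} → p ≋ q → ∂ i p ≋ ∂ i q
    ∂-cong {p} {q} p≋q m = begin
      coeff (∂ i p) m                                                 ≈⟨ coeff-∂ p m ⟩
      sumTerms (λ a e → termCoeff m (lookup e i ·ℕ a) (∂ₘ e)) p       ≈⟨ sumTerms-cong additive {p} {q} p≋q ⟩
      sumTerms (λ a e → termCoeff m (lookup e i ·ℕ a) (∂ₘ e)) q       ≈⟨ coeff-∂ q m ⟨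
      coeff (∂ i q) m                                                 ∎
      where
      open ≈-Reasoning
      additive = additive-∘ ∂ₘ (termCoeff-additive m) (·ℕ-additive (λ e → lookup e i))

    leibniz : ∀ p q → ∂ i (p *ₚ q) ≋ ((∂ i p *ₚ q) ++ (p *ₚ ∂ i q))
    leibniz p q m = begin
      coeff (∂ i (p *ₚ q)) m
        ≈⟨ coeff-∂ (p *ₚ q) m ⟩
      sumTerms (λ c h → tc (lookup h i ·ℕ c) (∂ₘ h)) (p *ₚ q)
        ≈⟨ sumTerms-* _ p q ⟩
      sumTerms (λ a e → sumTerms (λ b f → tc (lookup (e ⊕ f) i ·ℕ (a * b)) (∂ₘ (e ⊕ f))) q) p
        ≈⟨ sumTerms-pointwise (λ a e → sumTerms-pointwise (leibniz-term (termCoeff-additive m) a e) q) p ⟩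
      sumTerms (λ a e → sumTerms (λ b f → X a e b f + Y a e b f) q) p
        ≈⟨ trans (sumTerms-pointwise (λ a e → sumTerms-distrib-+ (X a e) (Y a e) q) p) (sumTerms-distrib-+ _ _ p) ⟩
      sumTerms (λ a e → sumTerms (X a e) q) p + sumTerms (λ a e → sumTerms (Y a e) q) p
        ≈⟨ +-cong ∂p*q p*∂q ⟨
      coeff (∂ i p *ₚ q) m + coeff (p *ₚ ∂ i q) m
        ≈⟨ coeff-++ (∂ i p *ₚ q) (p *ₚ ∂ i q) m ⟨
      coeff ((∂ i p *ₚ q) ++ (p *ₚ ∂ i q)) m ∎
      where
      open ≈-Reasoning
      tc = termCoeff m
      X Y : Carrier → Monomial n → Carrier → Monomial n → Carrier
      X a e b f = tc ((lookup e i ·ℕ a) * b) (∂ₘ e ⊕ f)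
      Y a e b f = tc (a * (lookup f i ·ℕ b)) (e ⊕ ∂ₘ f)
      ∂p*q : coeff (∂ i p *ₚ q) m ≈ sumTerms (λ a e → sumTerms (X a e) q) p
      ∂p*q = trans (coeff-sumTerms (∂ i p *ₚ q) m) (trans (sumTerms-* tc (∂ i p) q)
               (sumTerms-∂ (sumTerms-additive (λ b f → additive-∘ (_⊕ f) (termCoeff-additive m) (*ʳ-additive b)) q) p))
      p*∂q : coeff (p *ₚ ∂ i q) m ≈ sumTerms (λ a e → sumTerms (Y a e) q) p
      p*∂q = trans (coeff-sumTerms (p *ₚ ∂ i q) m) (trans (sumTerms-* tc p (∂ i q))
               (sumTerms-pointwise (λ a e → sumTerms-∂ (additive-∘ (e ⊕_) (termCoeff-additive m) (*ˡ-additive a)) q) p))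

  coeff-* : ∀ {n} (p q : Poly n) m →
            coeff (p *ₚ q) m ≈ sumTerms (λ a e → sumTerms (λ b f → termCoeff m (a * b) (e ⊕ f)) q) p
  coeff-* p q m = trans (coeff-sumTerms (p *ₚ q) m) (sumTerms-* (termCoeff m) p q)

  IsZero-*ˡ : ∀ {n} {p : Poly n} q → IsZero p → IsZero (p *ₚ q)
  IsZero-*ˡ {p = p} q p≋0 m = trans (coeff-* p q m) (sumTerms-cong additive {p} {[]} p≋0)
    where additive = sumTerms-additive (λ b f → additive-∘ (_⊕ f) (termCoeff-additive m) (*ʳ-additive b)) q

  IsZero-*ʳ : ∀ {n} p {q : Poly n} → IsZero q → IsZero (p *ₚ q)
  IsZero-*ʳ p {q} q≋0 m = trans (coeff-* p q m)
    (sumTerms-zero (λ a e → sumTerms-cong (additive a e) {q} {[]} q≋0) p)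
    where additive = λ a e → additive-∘ (e ⊕_) (termCoeff-additive m) (*ˡ-additive a)

  IsZero-++ : ∀ {n} {p q : Poly n} → IsZero p → IsZero q → IsZero (p ++ q)
  IsZero-++ {p = p} {q} p≋0 q≋0 m = trans (coeff-++ p q m) (trans (+-cong (p≋0 m) (q≋0 m)) (+-identityʳ 0#))

  id-additive : ∀ {n} → IsAdditive {n} (λ a _ → a)
  id-additive = record { cong = λ _ a≈b → a≈b ; homo = λ _ _ _ → refl }

  module Identification {n} (S : Subset n) (r : Fin n) where

    restrict : Monomial n → Fin n → ℕ
    restrict e i = if inS S i then lookup e i else 0

    identifiedExponent : Monomial n → Fin n → ℕ
    identifiedExponent e k =
      if does (k Fin.≟ r) then sum (map (restrict e) (allFin n)) else (if inS S k then 0 else lookup e k)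

    identifyMon-⊕ : ∀ e f → identifyMon S r (e ⊕ f) ≡ identifyMon S r e ⊕ identifyMon S r f
    identifyMon-⊕ e f = lookup-ext λ k → begin
      lookup (identifyMon S r (e ⊕ f)) k                              ≡⟨ VecP.lookup∘tabulate _ k ⟩
      identifiedExponent (e ⊕ f) k                                    ≡⟨ component k ⟩
      identifiedExponent e k ℕ.+ identifiedExponent f k               ≡⟨ ≡.cong₂ ℕ._+_ (VecP.lookup∘tabulate _ k) (VecP.lookup∘tabulate _ k) ⟨
      lookup (identifyMon S r e) k ℕ.+ lookup (identifyMon S r f) k   ≡⟨ lookup-⊕ (identifyMon S r e) (identifyMon S r f) k ⟨
      lookup (identifyMon S r e ⊕ identifyMon S r f) k                ∎
      where
      open ≡.≡-Reasoning
      restrict-⊕ : ∀ i → restrict (e ⊕ f) i ≡ restrict e i ℕ.+ restrict f i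
      restrict-⊕ i with lookup S i
      ... | inside  = lookup-⊕ e f i
      ... | outside = ≡.refl
      component : ∀ k → identifiedExponent (e ⊕ f) k ≡ identifiedExponent e k ℕ.+ identifiedExponent f k
      component k with k Fin.≟ r
      ... | yes _ = ≡.trans (sum-allFin (restrict (e ⊕ f))) (≡.trans (∑-cong restrict-⊕)
                    (≡.trans (∑-distrib-+ (restrict e) (restrict f))
                      (≡.sym (≡.cong₂ ℕ._+_ (sum-allFin (restrict e)) (sum-allFin (restrict f))))))
      ... | no _ with lookup S k
      ...   | inside  = ≡.refl
      ...   | outside = lookup-⊕ e f k

    unitMon : Fin n → Monomial n
    unitMon a = tabulate λ k → ⟦ k Fin.≟ a ⟧

    identifyMon-unit : ∀ {a} → a ∈ S → identifyMon S r (unitMon a) ≡ unitMon r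
    identifyMon-unit {a} a∈S = VecP.tabulate-cong component
      where
      a-inside : lookup S a ≡ inside
      a-inside = VecP.[]=⇒lookup a∈S
      outside⇒≢a : ∀ {k} → lookup S k ≡ outside → k ≢ a
      outside⇒≢a k-outside ≡.refl with () ← ≡.trans (≡.sym k-outside) a-inside
      restrict-unit : ∀ i → restrict (unitMon a) i ≡ ⟦ i Fin.≟ a ⟧
      restrict-unit i with lookup S i in i-side
      ... | inside  = VecP.lookup∘tabulate _ i
      ... | outside rewrite dec-false (i Fin.≟ a) (outside⇒≢a i-side) = ≡.refl
      component : ∀ k → identifiedExponent (unitMon a) k ≡ ⟦ k Fin.≟ r ⟧
      component k with k Fin.≟ r
      ... | yes _ = ≡.trans (sum-allFin (restrict (unitMon a))) (≡.trans (∑-cong restrict-unit) (∑-δ a))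
      ... | no _ with lookup S k in k-side
      ...   | inside  = ≡.refl
      ...   | outside rewrite VecP.lookup∘tabulate (λ k → ⟦ k Fin.≟ a ⟧) k
                            | dec-false (k Fin.≟ a) (outside⇒≢a k-side) = ≡.refl

    identify-++ : ∀ (p q : Poly n) → identify S r (p ++ q) ≡ identify S r p ++ identify S r q
    identify-++ p q = ListP.map-++ _ p q

    identify-* : ∀ (p q : Poly n) → identify S r (p *ₚ q) ≡ identify S r p *ₚ identify S r q
    identify-* []             q = ≡.refl
    identify-* ((a , e) ∷ p) q =
      ≡.trans (identify-++ (map (λ { (b , f) → (a * b , e ⊕ f) }) q) (p *ₚ q))
              (≡.cong₂ _++_ (identify-term q) (identify-* p q))
      where
      identify-term : ∀ q → identify S r (map (λ { (b , f) → (a * b , e ⊕ f) }) q)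
                          ≡ map (λ { (b , f) → (a * b , identifyMon S r e ⊕ f) }) (identify S r q)
      identify-term []             = ≡.refl
      identify-term ((b , f) ∷ q) = ≡.cong₂ _∷_ (≡.cong (a * b ,_) (identifyMon-⊕ e f)) (identify-term q)

    identify-cong : ∀ {p q} → p ≋ q → identify S r p ≋ identify S r q
    identify-cong {p} {q} p≋q m = begin
      coeff (identify S r p) m                                  ≈⟨ coeff-identify p ⟩
      sumTerms (λ a e → termCoeff m a (identifyMon S r e)) p    ≈⟨ sumTerms-cong additive {p} {q} p≋q ⟩
      sumTerms (λ a e → termCoeff m a (identifyMon S r e)) q    ≈⟨ coeff-identify q ⟨
      coeff (identify S r q) m                                  ∎
      where
      open ≈-Reasoning
      additive = additive-∘ (identifyMon S r) (termCoeff-additive m) id-additive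
      coeff-identify : ∀ p → coeff (identify S r p) m ≈ sumTerms (λ a e → termCoeff m a (identifyMon S r e)) p
      coeff-identify p = trans (coeff-sumTerms (identify S r p) m) (reflexive (sumTerms-map (termCoeff m) _ p))

    identify-var-diff : ∀ {a b} → a ∈ S → b ∈ S → IsZero (identify S r (var a -ₚ var b))
    identify-var-diff a∈S b∈S m rewrite identifyMon-unit a∈S | identifyMon-unit b∈S with unitMon r ≟ₘ m
    ... | yes _ = trans (+-congˡ (+-identityʳ (- 1#))) (-‿inverseʳ 1#)
    ... | no _  = refl

module DifferenceIdeal {c ℓ} (R : CommutativeRing c ℓ) where
  open import Level using (_⊔_)
  open import Data.Bool as Bool using (true; false)
  open import Data.Nat as ℕ using (zero; suc; _+_; _∸_; _<_; z≤n; s≤s)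
  import Data.Nat.Properties as ℕP
  open import Data.Fin using (Fin)
  open import Data.Fin.Subset using (Subset; _∈_; ∣_∣)
  open import Data.List as List using (List; []; _∷_; map; filter; length)
  open import Data.List.Relation.Unary.All using (All; []; _∷_)
  open import Data.Product using (Σ; _×_; _,_; proj₁; proj₂)
  open import Data.Empty using (⊥; ⊥-elim)
  open import Relation.Nullary using (¬_; Dec; yes; no)
  open import Relation.Binary.PropositionalEquality as ≡ using (_≡_)
  open CommutativeRing R using (refl; sym; trans)
  open Polynomials R
  open PolynomialAlgebra R
  open TriplesThroughPair R

  -- DiffIdeal S k p means p ∈ J^k, where J is the ideal generated by the x_a − x_b with a, b ∈ S.
  data DiffIdeal {n} (S : Subset n) : ℕ → Poly n → Set (c ⊔ ℓ) where
    whole : ∀ p → DiffIdeal S 0 p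
    null  : ∀ {k} → DiffIdeal S k 0ₚ
    diff  : ∀ {a b} → a ∈ S → b ∈ S → DiffIdeal S 1 (var a -ₚ var b)
    lower : ∀ {k p} → DiffIdeal S (suc k) p → DiffIdeal S k p
    _+ᴵ_  : ∀ {k p q} → DiffIdeal S k p → DiffIdeal S k q → DiffIdeal S k (p +ₚ q)
    _*ᴵ_  : ∀ {k m p q} → DiffIdeal S k p → DiffIdeal S m q → DiffIdeal S (k + m) (p *ₚ q)
    resp  : ∀ {k p q} → p ≋ q → DiffIdeal S k p → DiffIdeal S k q

  module _ {n} {S : Subset n} where

    lower-≤ : ∀ {j k p} → j ≤ k → DiffIdeal S k p → DiffIdeal S j p
    lower-≤ j≤k = go (ℕP.≤⇒≤′ j≤k)
      where
      go : ∀ {j k p} → j ℕ.≤′ k → DiffIdeal S k p → DiffIdeal S j p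
      go ℕ.≤′-refl        p∈J = p∈J
      go (ℕ.≤′-step j≤′k) p∈J = go j≤′k (lower p∈J)

    lower-pred : ∀ {k p} → DiffIdeal S k p → DiffIdeal S (ℕ.pred k) p
    lower-pred {zero}  p∈J = p∈J
    lower-pred {suc k} p∈J = lower p∈J

    ∂-DiffIdeal : ∀ i {k p} → DiffIdeal S k p → DiffIdeal S (ℕ.pred k) (∂ i p)
    ∂-DiffIdeal i (whole p)       = whole (∂ i p)
    ∂-DiffIdeal i null            = null
    ∂-DiffIdeal i (diff _ _)      = whole _
    ∂-DiffIdeal i (lower p∈J)     = lower-pred (∂-DiffIdeal i p∈J)
    ∂-DiffIdeal i (_+ᴵ_ {p = p} {q} p∈J q∈J) =
      ≡.subst (DiffIdeal S _) (≡.sym (Derivative.∂-++ i p q)) (∂-DiffIdeal i p∈J +ᴵ ∂-DiffIdeal i q∈J)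
    ∂-DiffIdeal i (_*ᴵ_ {k} {m} {p} {q} p∈J q∈J) =
      resp (λ x → sym (Derivative.leibniz i p q x))
        (lower-≤ (pred-+ˡ k m) (∂-DiffIdeal i p∈J *ᴵ q∈J) +ᴵ lower-≤ (pred-+ʳ k m) (p∈J *ᴵ ∂-DiffIdeal i q∈J))
      where
      pred-+ˡ : ∀ k m → ℕ.pred (k + m) ≤ ℕ.pred k + m
      pred-+ˡ zero    m = ℕP.pred[n]≤n
      pred-+ˡ (suc k) m = ℕP.≤-refl
      pred-+ʳ : ∀ k m → ℕ.pred (k + m) ≤ k + ℕ.pred m
      pred-+ʳ k m = ℕP.≤-trans (ℕP.≤-reflexive (≡.cong ℕ.pred (ℕP.+-comm k m)))
                               (ℕP.≤-trans (pred-+ˡ m k) (ℕP.≤-reflexive (ℕP.+-comm (ℕ.pred m) k)))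
    ∂-DiffIdeal i (resp {p = p} {q} p≋q p∈J) = resp (Derivative.∂-cong i {p} {q} p≋q) (∂-DiffIdeal i p∈J)

    ∂^-DiffIdeal : ∀ i j {k p} → DiffIdeal S k p → DiffIdeal S (k ∸ j) (∂^ j i p)
    ∂^-DiffIdeal i zero    p∈J = p∈J
    ∂^-DiffIdeal i (suc j) {k} {p} p∈J =
      ≡.subst (λ k′ → DiffIdeal S k′ (∂^ (suc j) i p)) (ℕP.pred[m∸n]≡m∸[1+n] k j)
              (∂-DiffIdeal i (∂^-DiffIdeal i j p∈J))

    identify-DiffIdeal : ∀ r {k p} → DiffIdeal S k p → 0 < k → IsZero (identify S r p)
    identify-DiffIdeal r null          _ _ = refl
    identify-DiffIdeal r (diff a∈S b∈S) _   = Identification.identify-var-diff S r a∈S b∈S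
    identify-DiffIdeal r (lower p∈J)   _   = identify-DiffIdeal r p∈J (s≤s z≤n)
    identify-DiffIdeal r (_+ᴵ_ {p = p} {q} p∈J q∈J) 0<k
      rewrite Identification.identify-++ S r p q =
        IsZero-++ {p = identify S r p} (identify-DiffIdeal r p∈J 0<k) (identify-DiffIdeal r q∈J 0<k)
    identify-DiffIdeal r (_*ᴵ_ {zero} {p = p} {q} p∈J q∈J) 0<m
      rewrite Identification.identify-* S r p q =
        IsZero-*ʳ (identify S r p) (identify-DiffIdeal r q∈J 0<m)
    identify-DiffIdeal r (_*ᴵ_ {suc k} {p = p} {q} p∈J q∈J) _
      rewrite Identification.identify-* S r p q =
        IsZero-*ˡ {p = identify S r p} (identify S r q) (identify-DiffIdeal r p∈J (s≤s z≤n))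
    identify-DiffIdeal r (resp {p = p} {q} p≋q p∈J) 0<k m =
      trans (sym (Identification.identify-cong S r {p} {q} p≋q m)) (identify-DiffIdeal r p∈J 0<k m)

  factor : ∀ {n} → Fin n × Fin n × Fin n → Poly n
  factor (i , j , k) = ((var i -ₚ var j) *ₚ (var i -ₚ var k)) *ₚ (var j -ₚ var k)

  nonEdge? : ∀ {n} (G : ThreeGraph n) t → Dec (notEdge G t ≡ true)
  nonEdge? G t = notEdge G t Bool.≟ true

  module _ {n} {S : Subset n} {a b : Fin n} (a∈S : a ∈ S) (b∈S : b ∈ S) where

    factor-DiffIdeal : ∀ {t} → Through a b t → DiffIdeal S 1 (factor t)
    factor-DiffIdeal (ab∙ k) = (diff a∈S b∈S *ᴵ whole (var a -ₚ var k)) *ᴵ whole (var b -ₚ var k)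
    factor-DiffIdeal (a∙b j) = (whole (var a -ₚ var j) *ᴵ diff a∈S b∈S) *ᴵ whole (var j -ₚ var b)
    factor-DiffIdeal (∙ab i) = whole ((var i -ₚ var a) *ₚ (var i -ₚ var b)) *ᴵ diff a∈S b∈S

    module _ {m} {G : ThreeGraph n} (P : Partite m G) (same : proj₁ P a ≡ proj₁ P b) where
      open Σ P renaming (proj₁ to colour; proj₂ to proper)

      through⇒nonEdge : ∀ {t} → Increasing t → Through a b t → notEdge G t ≡ true
      through⇒nonEdge {i , j , k} (i<j , j<k) through with G i j k in edge
      ... | false = ≡.refl
      ... | true  = ⊥-elim (separated through (proper i j k i<j j<k edge))
        where
        separated : Through a b (i , j , k) →
                    ¬ colour i ≡ colour j × ¬ colour i ≡ colour k × ¬ colour j ≡ colour k → ⊥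
        separated (ab∙ _) (a≢b , _ , _) = a≢b same
        separated (a∙b _) (_ , a≢b , _) = a≢b same
        separated (∙ab _) (_ , _ , a≢b) = a≢b same

      nonEdges-DiffIdeal : ∀ ts → All Increasing ts →
                           DiffIdeal S (length (filter (through? a b) ts)) (prodₚ (map factor (filter (nonEdge? G) ts)))
      nonEdges-DiffIdeal []       []             = whole 1ₚ
      nonEdges-DiffIdeal (t ∷ ts) (t↑ ∷ ts↑) with through? a b t
      ... | yes through rewrite through⇒nonEdge t↑ through =
        factor-DiffIdeal through *ᴵ nonEdges-DiffIdeal ts ts↑
      ... | no _ with notEdge G t
      ...   | true  = whole (factor t) *ᴵ nonEdges-DiffIdeal ts ts↑
      ...   | false = nonEdges-DiffIdeal ts ts↑

  pG-DiffIdeal : ∀ {n m} {G : ThreeGraph n} → Partite m G → ∀ S → m < ∣ S ∣ → DiffIdeal S (n ∸ 2) (pG G)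
  pG-DiffIdeal {n} P@(colour , _) S m<∣S∣ with a , b , a∈S , b∈S , a<b , same ← pigeonhole-⊆ S colour m<∣S∣ =
    lower-≤ (n∸2≤length-filter-triples a<b) (nonEdges-DiffIdeal a∈S b∈S P same (triples n) (triples-increasing n))

  generated-DiffIdeal : ∀ {n m} (S : Subset n) → m < ∣ S ∣ → (gens : List (Poly n × ThreeGraph n)) →
                        All (λ g → Partite m (proj₂ g)) gens →
                        DiffIdeal S (n ∸ 2) (sumₚ (map (λ { (q , G) → q *ₚ pG G }) gens))
  generated-DiffIdeal S m<∣S∣ []               []       = null
  generated-DiffIdeal S m<∣S∣ ((q , G) ∷ gens) (P ∷ Ps) =
    (whole q *ᴵ pG-DiffIdeal P S m<∣S∣) +ᴵ generated-DiffIdeal S m<∣S∣ gens Ps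

  P̂⊆DI : ∀ l n → 3 ≤ l → l ≤ n → (p : Poly n) → InPhat n l p → InDI n l p
  P̂⊆DI l n 3≤l l≤n p (gens , partite , p≋combination) i j j≤n∸3 S r _ ∣S∣≡l =
    identify-DiffIdeal r (∂^-DiffIdeal i j p∈J^[n∸2]) (ℕP.m<n⇒0<n∸m j<n∸2)
    where
    l∸1<∣S∣ : l ∸ 1 < ∣ S ∣
    l∸1<∣S∣ = ≡.subst (l ∸ 1 <_) (≡.sym ∣S∣≡l) (ℕP.∸-monoʳ-< (s≤s z≤n) (ℕP.≤-trans (s≤s z≤n) 3≤l))
    p∈J^[n∸2] : DiffIdeal S (n ∸ 2) p
    p∈J^[n∸2] = resp (λ m → sym (p≋combination m)) (generated-DiffIdeal S l∸1<∣S∣ gens partite)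
    j<n∸2 : j < n ∸ 2
    j<n∸2 = ℕP.≤-<-trans j≤n∸3 (ℕP.∸-monoʳ-< ℕP.≤-refl (ℕP.≤-trans 3≤l l≤n))

lemma3p1 : ∀ {c ℓ : Level} (F : Field c ℓ) → CharZero F →
    (l n : ℕ) → 3 ≤ l → l ≤ n →
    (p : Polynomials.Poly (Field.commutativeRing F) n) →
    Polynomials.InPhat (Field.commutativeRing F) n l p →
    Polynomials.InDI (Field.commutativeRing F) n l p
lemma3p1 F _ = DifferenceIdeal.P̂⊆DI (Field.commutativeRing F)
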